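{- Let $V$ be a finite set of boxes with size function $w:V\to[0,1]^d$, let $(G_1,\dots,G_d)$ with $G_i=(V,E_i)$ be a packing class for $(V,w)$, let $w'$ be a conservative scale for $(V,w)$, let $i\in\{1,\dots,d\}$ and $S\subseteq V$. Then the induced subgraph $G_i[S]$ contains a clique of cardinality $\lceil\sum_{b\in S}w'_i(b)\rceil$.
   Context: For a size function $w$ and coordinate $i$, $\mathcal F(V,w_i)=\{S\subseteq V:\sum_{b\in S}w_i(b)\le1\}$. A packing class for $(V,w)$ is a $d$-tuple of graphs $G_i=(V,E_i)$ such that each $G_i$ is an interval graph, every stable set of $G_i$ lies in $\mathcal F(V,w_i)$, and $\bigcap_{i=1}^dE_i=\emptyset$. A function $w':V\to\mathbb R_{\ge0}^d$ is a conservative scale for $(V,w)$ if $\mathcal F(V,w_i)\subseteq\mathcal F(V,w'_i)$ for all $i$.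
   Formalization: The size function w and the conservative scale w' take rational values rather than real ones. -}

module Defs where

open import Data.Nat using (ℕ; zero; suc)
open import Data.Fin using (Fin; zero; suc)
open import Data.Fin.Subset using (Subset; _∈_; _⊆_)
open import Data.Vec using (Vec; []; _∷_)
open import Data.Bool using (true; false)
open import Data.Rational using (ℚ; 0ℚ; 1ℚ; _+_; _≤_)
open import Data.Product using (Σ; _×_; ∃)
open import Relation.Nullary using (¬_)
open import Relation.Binary.PropositionalEquality using (_≢_)
open import Function.Bundles using (_⇔_)

-- A finite vertex set V is modelled as Fin n; a graph on V is an edge
-- relation E : Fin n → Fin n → Set (only pairs of distinct vertices matter).
Graph : ℕ → Set₁
Graph n = Fin n → Fin n → Set

sumOver : ∀ {n} → (Fin n → ℚ) → Subset n → ℚ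
sumOver {zero}  f []          = 0ℚ
sumOver {suc n} f (true ∷ S)  = f zero + sumOver (λ b → f (suc b)) S
sumOver {suc n} f (false ∷ S) = sumOver (λ b → f (suc b)) S

-- Size functions: w b i is the i-th coordinate of the size of box b.
Size : ℕ → ℕ → Set
Size n d = Fin n → Fin d → ℚ

InF : ∀ {n d} → Size n d → Fin d → Subset n → Set
InF w i S = sumOver (λ b → w b i) S ≤ 1ℚ

-- Interval graph: vertices are assigned closed intervals [l v, r v]
-- so that distinct u, v are adjacent iff their intervals intersect.
-- (For finite graphs rational endpoints suffice.)
IsIntervalGraph : ∀ {n} → Graph n → Set
IsIntervalGraph {n} E =
  Σ (Fin n → ℚ) λ l → Σ (Fin n → ℚ) λ r →
    (∀ v → l v ≤ r v) ×
    (∀ u v → u ≢ v → (E u v ⇔ (l u ≤ r v × l v ≤ r u)))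

IsStable : ∀ {n} → Graph n → Subset n → Set
IsStable E S = ∀ u v → u ∈ S → v ∈ S → u ≢ v → ¬ E u v

IsClique : ∀ {n} → Graph n → Subset n → Set
IsClique E S = ∀ u v → u ∈ S → v ∈ S → u ≢ v → E u v

IsPackingClass : ∀ {n d} → Size n d → (Fin d → Graph n) → Set
IsPackingClass {n} {d} w G =
  (∀ i → IsIntervalGraph (G i)) ×
  (∀ i S → IsStable (G i) S → InF w i S) ×
  (∀ u v → u ≢ v → ¬ (∀ i → G i u v))

IsConservativeScale : ∀ {n d} → Size n d → Size n d → Set
IsConservativeScale {n} {d} w w' =
  (∀ b i → 0ℚ ≤ w' b i) × (∀ i S → InF w i S → InF w' i S)

IsUnitSize : ∀ {n d} → Size n d → Set
IsUnitSize w = ∀ b i → (0ℚ ≤ w b i) × (w b i ≤ 1ℚ)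

{-# OPTIONS --safe #-}
module Submission where

-- Represent G_i by intervals [l b, r b]; the intervals of S through a point q (the stab of S at q)
-- form a clique. Take the interval with the leftmost left end, then greedily the intervals lying
-- wholly to the right of those already taken: this layer is pairwise disjoint, hence stable in G_i,
-- so its w'_i-weight is at most 1, and every stab of the remaining intervals is strictly contained
-- in a stab of S. Peeling off layers shows that the weight of S is at most the size of some stab,
-- and a subset of that stab of size ⌈Σ w'_i⌉ is the required clique.

open import Defs
open import Algebra.Bundles using (CommutativeMonoid)
open import Data.Bool.Properties using (T-≡)
open import Data.Empty using (⊥-elim)
open import Data.Fin using (Fin; zero; suc)
open import Data.Fin.Subset
  using (Subset; _∈_; _∉_; _⊆_; _⊂_; _∩_; _∪_; _─_; ⁅_⁆; ⊥; ∣_∣; Nonempty; Empty; inside; outside)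
open import Data.Fin.Subset.Properties
  using (⊥⊆; ∉⊥; ∣⊥∣≡0; s⊆s; x∈p∩q⁺; x∈p∩q⁻; p∩q⊆q; x∈p∪q⁺; x∈p∪q⁻; x∈⁅x⁆; x∈⁅y⁆⇒x≡y;
         x∈p∧x∉q⇒x∈p─q; p─q⊆p; p∩q≢∅⇒p─q⊂p; p⊂q⇒∣p∣<∣q∣; Empty-unique; nonempty?)
open import Data.Fin.Subset.Induction using (⊂-wellFounded)
open import Data.Integer as ℤ using (+_; -[1+_]; +≤+)
import Data.Integer.DivMod as ℤ
import Data.Integer.Properties as ℤP
open import Data.Nat as ℕ using (ℕ; zero; suc; z≤n; s≤s)
import Data.Nat.DivMod as ℕ
import Data.Nat.Properties as ℕP
open import Data.Product using (Σ; ∃-syntax; _×_; _,_; proj₁; proj₂)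
open import Data.Rational using (ℚ; mkℚ; 0ℚ; 1ℚ; _≤_; _<_; *≤*; _+_; ceiling)
open import Data.Rational.Literals using (fromℤ)
import Data.Rational.Properties as ℚP
import Data.Rational.Unnormalised as ℚᵘ
import Data.Rational.Unnormalised.Properties as ℚᵘP
open import Data.Sum as Sum using (_⊎_; inj₁; inj₂)
open import Data.Vec using ([]; _∷_; tabulate; here; there)
open import Data.Vec.Properties using (lookup∘tabulate; []=⇒lookup; lookup⇒[]=)
open import Function using (_∘_)
open import Function.Bundles using (Equivalence; _⇔_)
open import Induction.WellFounded using (WfRec; module All)
open import Level using (Level)
open import Relation.Binary.PropositionalEquality using (_≡_; _≢_; refl; sym; trans; cong; cong₂; subst₂)
open import Relation.Nullary using (¬_; yes; no)
open import Relation.Nullary.Decidable using (⌊_⌋; toWitness; fromWitness; _×-dec_)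
open import Relation.Unary using (Pred; Decidable)
open import Algebra.Properties.CommutativeSemigroup
  (CommutativeMonoid.commutativeSemigroup ℚP.+-0-commutativeMonoid) using (x∙yz≈y∙xz)

private
  variable
    n : ℕ

fromℤ-homo-+ : ∀ i j → fromℤ (i ℤ.+ j) ≡ fromℤ i + fromℤ j
fromℤ-homo-+ i j =
  ℚP.toℚᵘ-injective (ℚᵘP.≃-sym (ℚᵘP.≃-trans (ℚP.toℚᵘ-homo-+ (fromℤ i) (fromℤ j)) (ℚᵘ.*≡* eq)))
  where
  eq : (i ℤ.* + 1 ℤ.+ j ℤ.* + 1) ℤ.* + 1 ≡ (i ℤ.+ j) ℤ.* + 1
  eq = cong (ℤ._* + 1) (cong₂ ℤ._+_ (ℤP.*-identityʳ i) (ℤP.*-identityʳ j))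

fromℤ-mono-≤ : ∀ {i j} → i ℤ.≤ j → fromℤ i ≤ fromℤ j
fromℤ-mono-≤ i≤j = *≤* (ℤP.*-monoʳ-≤-nonNeg (+ 1) i≤j)

-- ℤ's _/ℕ_ rounds towards -∞, so this is the ceiling of (1 + n) / D.
neg-/ℕ-bounded : ∀ n D m .{{_ : ℕ.NonZero D}} → suc n ℕ.≤ m ℕ.* D →
                 ∃[ k ] k ℕ.≤ m × ℤ.- (-[1+ n ] ℤ./ℕ D) ≡ + k
neg-/ℕ-bounded n D m 1+n≤mD with suc n ℕ.% D in rem
... | zero  = suc n ℕ./ D , ℕP.≤-trans (ℕ./-monoˡ-≤ D 1+n≤mD) (ℕP.≤-reflexive (ℕ.m*n/n≡m m D)) ,
              ℤP.neg-involutive _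
... | suc r = suc q , ℕP.*-cancelʳ-< D q m qD<mD , refl
  where
  q : ℕ
  q = suc n ℕ./ D
  1+n≡1+r+qD : suc n ≡ suc r ℕ.+ q ℕ.* D
  1+n≡1+r+qD = trans (ℕ.m≡m%n+[m/n]*n (suc n) D) (cong (ℕ._+ q ℕ.* D) rem)
  qD<mD : q ℕ.* D ℕ.< m ℕ.* D
  qD<mD = ℕP.<-≤-trans (ℕP.m<n+m (q ℕ.* D) {suc r} (s≤s z≤n))
            (ℕP.≤-trans (ℕP.≤-reflexive (sym 1+n≡1+r+qD)) 1+n≤mD)

⌈⌉-bounded : ∀ p m → 0ℚ ≤ p → p ≤ fromℤ (+ m) → ∃[ k ] k ℕ.≤ m × ⌈ p ⌉ ≡ + k
⌈⌉-bounded (mkℚ (+ zero)  d _) m _        _       = 0 , z≤n , refl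
⌈⌉-bounded (mkℚ -[1+ n ]  d _) m (*≤* ()) _
⌈⌉-bounded (mkℚ (+ suc n) d _) m _        (*≤* p≤m)
  with k , k≤m , eq ← neg-/ℕ-bounded n (suc d) m
         (ℤP.drop‿+≤+ (subst₂ ℤ._≤_ (ℤP.*-identityʳ (+ suc n)) (sym (ℤP.pos-* m (suc d))) p≤m))
  = k , k≤m , trans (cong ℤ.-_ (ℤ.div-pos-is-/ℕ -[1+ n ] (suc d))) eq

sumOver-⊥ : (f : Fin n → ℚ) → sumOver f ⊥ ≡ 0ℚ
sumOver-⊥ {zero}  f = refl
sumOver-⊥ {suc n} f = sumOver-⊥ (f ∘ suc)

sumOver-nonNeg : (f : Fin n → ℚ) → (∀ b → 0ℚ ≤ f b) → ∀ P → 0ℚ ≤ sumOver f P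
sumOver-nonNeg f f≥0 []            = ℚP.≤-refl
sumOver-nonNeg f f≥0 (outside ∷ P) = sumOver-nonNeg (f ∘ suc) (f≥0 ∘ suc) P
sumOver-nonNeg f f≥0 (inside ∷ P)  =
  subst₂ _≤_ (ℚP.+-identityˡ 0ℚ) refl (ℚP.+-mono-≤ (f≥0 zero) (sumOver-nonNeg (f ∘ suc) (f≥0 ∘ suc) P))

sumOver-∩-─ : (f : Fin n → ℚ) (P A : Subset n) → sumOver f P ≡ sumOver f (P ∩ A) + sumOver f (P ─ A)
sumOver-∩-─ f []            []            = refl
sumOver-∩-─ f (outside ∷ P) (inside ∷ A)  = sumOver-∩-─ (f ∘ suc) P A
sumOver-∩-─ f (outside ∷ P) (outside ∷ A) = sumOver-∩-─ (f ∘ suc) P A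
sumOver-∩-─ f (inside ∷ P)  (inside ∷ A)  =
  trans (cong (_+_ (f zero)) (sumOver-∩-─ (f ∘ suc) P A)) (sym (ℚP.+-assoc (f zero) _ _))
sumOver-∩-─ f (inside ∷ P)  (outside ∷ A) =
  trans (cong (_+_ (f zero)) (sumOver-∩-─ (f ∘ suc) P A))
        (x∙yz≈y∙xz (f zero) (sumOver (f ∘ suc) (P ∩ A)) (sumOver (f ∘ suc) (P ─ A)))

subset-of-size : ∀ (Q : Subset n) {k} → k ℕ.≤ ∣ Q ∣ → ∃[ K ] K ⊆ Q × ∣ K ∣ ≡ k
subset-of-size {n} Q         {zero}  _ = ⊥ , ⊥⊆ , ∣⊥∣≡0 n
subset-of-size (outside ∷ Q) {suc k} k<∣Q∣ with K , K⊆Q , ∣K∣≡k ← subset-of-size Q k<∣Q∣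
  = outside ∷ K , s⊆s K⊆Q , ∣K∣≡k
subset-of-size (inside ∷ Q)  {suc k} (s≤s k≤∣Q∣) with K , K⊆Q , ∣K∣≡k ← subset-of-size Q k≤∣Q∣
  = inside ∷ K , s⊆s K⊆Q , cong suc ∣K∣≡k

x∈p─q⇒x∉q : ∀ {x} (p q : Subset n) → x ∈ p ─ q → x ∉ q
x∈p─q⇒x∉q (s ∷ p) (outside ∷ q) (there x∈) (there x∈q) = x∈p─q⇒x∉q p q x∈ x∈q
x∈p─q⇒x∉q (s ∷ p) (inside ∷ q)  (there x∈) (there x∈q) = x∈p─q⇒x∉q p q x∈ x∈q

least : ∀ (f : Fin n → ℚ) {P} → Nonempty P → ∃[ v ] v ∈ P × ∀ {b} → b ∈ P → f v ≤ f b
least f {outside ∷ P} (suc b , there b∈P)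
  with v , v∈P , v-least ← least (f ∘ suc) (b , b∈P)
  = suc v , there v∈P , λ { (there b∈P) → v-least b∈P }
least f {inside ∷ P} _ with nonempty? P
... | no P-empty = zero , here , λ { here → ℚP.≤-refl ; (there b∈P) → ⊥-elim (P-empty (_ , b∈P)) }
... | yes P-nonempty with v , v∈P , v-least ← least (f ∘ suc) P-nonempty | f zero ℚP.≤? f (suc v)
...   | yes f0≤fv = zero , here , λ { here → ℚP.≤-refl ; (there b∈P) → ℚP.≤-trans f0≤fv (v-least b∈P) }
...   | no  f0≰fv = suc v , there v∈P ,
          λ { here → ℚP.<⇒≤ (ℚP.≰⇒> f0≰fv) ; (there b∈P) → v-least b∈P }

module _ {ℓ : Level} {Q : Pred (Fin n) ℓ} (Q? : Decidable Q) where

  filter : Subset n → Subset n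
  filter P = P ∩ tabulate (⌊_⌋ ∘ Q?)

  ∈-filter⁺ : ∀ {P x} → x ∈ P → Q x → x ∈ filter P
  ∈-filter⁺ {P} {x} x∈P Qx = x∈p∩q⁺ (x∈P , lookup⇒[]= x _
    (trans (lookup∘tabulate (⌊_⌋ ∘ Q?) x) (Equivalence.to T-≡ (fromWitness Qx))))

  ∈-filter⁻ : ∀ {P x} → x ∈ filter P → x ∈ P × Q x
  ∈-filter⁻ {P} {x} x∈ with x∈P , x∈Q ← x∈p∩q⁻ P _ x∈
    = x∈P , toWitness (Equivalence.from T-≡ (trans (sym (lookup∘tabulate (⌊_⌋ ∘ Q?) x)) ([]=⇒lookup x∈Q)))

module Intervals {n : ℕ} (l r : Fin n → ℚ) (l≤r : ∀ b → l b ≤ r b) where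

  Covers : ℚ → Fin n → Set
  Covers q b = l b ≤ q × q ≤ r b

  Overlap : Fin n → Fin n → Set
  Overlap a b = l a ≤ r b × l b ≤ r a

  PairwiseDisjoint : Subset n → Set
  PairwiseDisjoint A = ∀ {a b} → a ∈ A → b ∈ A → a ≢ b → ¬ Overlap a b

  stab : Subset n → ℚ → Subset n
  stab P q = filter (λ b → l b ℚP.≤? q ×-dec q ℚP.≤? r b) P

  stab⁺ : ∀ {P q b} → b ∈ P → Covers q b → b ∈ stab P q
  stab⁺ = ∈-filter⁺ _

  stab⁻ : ∀ {P q b} → b ∈ stab P q → b ∈ P × Covers q b
  stab⁻ = ∈-filter⁻ _

  stab-mono : ∀ {P Q q} → P ⊆ Q → stab P q ⊆ stab Q q
  stab-mono P⊆Q b∈ with b∈P , covers ← stab⁻ b∈ = stab⁺ (P⊆Q b∈P) covers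

  stab-overlap : ∀ {P q a b} → a ∈ stab P q → b ∈ stab P q → Overlap a b
  stab-overlap a∈ b∈ with _ , la≤q , q≤ra ← stab⁻ a∈ | _ , lb≤q , q≤rb ← stab⁻ b∈
    = ℚP.≤-trans la≤q q≤rb , ℚP.≤-trans lb≤q q≤ra

  -- Asking for q ≤ p is what lets the greedy recursion in cons-layer go through.
  Absorbed : Subset n → Subset n → ℚ → Set
  Absorbed P A p = ∃[ q ] q ≤ p × stab (P ─ A) p ⊆ stab P q × ∃[ a ] a ∈ A × Covers q a

  record Layer (P : Subset n) : Set where
    field
      layer    : Subset n
      layer⊆P  : layer ⊆ P
      disjoint : PairwiseDisjoint layer
      nonempty : Nonempty P → Nonempty layer
      absorbs  : ∀ p → Nonempty (stab (P ─ layer) p) → Absorbed P layer p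

  empty-layer : ∀ {P} → Empty P → Layer P
  empty-layer {P} P-empty = record
    { layer    = ⊥
    ; layer⊆P  = ⊥⊆
    ; disjoint = λ a∈⊥ → ⊥-elim (∉⊥ a∈⊥)
    ; nonempty = ⊥-elim ∘ P-empty
    ; absorbs  = λ { p (y , y∈) → ⊥-elim (P-empty (y , p─q⊆p P ⊥ (proj₁ (stab⁻ y∈)))) }
    }

  after : Fin n → Subset n → Subset n
  after v = filter (λ b → r v ℚP.<? l b)

  cons-layer : ∀ {P v} → v ∈ P → (∀ {b} → b ∈ P → l v ≤ l b) → Layer (after v P) → Layer P
  cons-layer {P} {v} v∈P v-least L = record
    { layer    = A
    ; layer⊆P  = A⊆P
    ; disjoint = A-disjoint
    ; nonempty = λ _ → v , v∈A
    ; absorbs  = A-absorbs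
    }
    where
    open Layer L renaming (layer to A′; layer⊆P to A′⊆R; disjoint to A′-disjoint; absorbs to A′-absorbs)
    R : Subset n
    R = after v P

    A : Subset n
    A = ⁅ v ⁆ ∪ A′

    v∈A : v ∈ A
    v∈A = x∈p∪q⁺ (inj₁ (x∈⁅x⁆ v))

    A′⊆A : A′ ⊆ A
    A′⊆A = x∈p∪q⁺ ∘ inj₂

    ∈A⁻ : ∀ {a} → a ∈ A → a ≡ v ⊎ a ∈ A′
    ∈A⁻ a∈A = Sum.map₁ (x∈⁅y⁆⇒x≡y v) (x∈p∪q⁻ ⁅ v ⁆ A′ a∈A)

    R⊆P : R ⊆ P
    R⊆P = proj₁ ∘ ∈-filter⁻ _

    A′-after : ∀ {a} → a ∈ A′ → r v < l a
    A′-after = proj₂ ∘ ∈-filter⁻ _ ∘ A′⊆R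

    A⊆P : A ⊆ P
    A⊆P a∈A with ∈A⁻ a∈A
    ... | inj₁ refl = v∈P
    ... | inj₂ a∈A′ = R⊆P (A′⊆R a∈A′)

    A-disjoint : PairwiseDisjoint A
    A-disjoint a∈A b∈A a≢b with ∈A⁻ a∈A | ∈A⁻ b∈A
    ... | inj₁ refl | inj₁ refl = ⊥-elim (a≢b refl)
    ... | inj₁ refl | inj₂ b∈A′ = λ (_ , lb≤rv) → ℚP.<-irrefl refl (ℚP.<-≤-trans (A′-after b∈A′) lb≤rv)
    ... | inj₂ a∈A′ | inj₁ refl = λ (la≤rv , _) → ℚP.<-irrefl refl (ℚP.<-≤-trans (A′-after a∈A′) la≤rv)
    ... | inj₂ a∈A′ | inj₂ b∈A′ = A′-disjoint a∈A′ b∈A′ a≢b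

    stab-late : ∀ {p y} → y ∈ stab (P ─ A) p → ¬ l y ≤ r v → y ∈ stab (R ─ A′) p
    stab-late {y = y} y∈ ly≰rv with y∈P─A , covers ← stab⁻ y∈ = stab⁺ (x∈p∧x∉q⇒x∈p─q y∈R y∉A′) covers
      where
      y∈R : y ∈ R
      y∈R = ∈-filter⁺ _ (p─q⊆p P A y∈P─A) (ℚP.≰⇒> ly≰rv)
      y∉A′ : y ∉ A′
      y∉A′ = x∈p─q⇒x∉q P A y∈P─A ∘ A′⊆A

    stab-early : ∀ {p q y} → r v ≤ q → q ≤ p → y ∈ stab (P ─ A) p → l y ≤ r v → y ∈ stab P q
    stab-early rv≤q q≤p y∈ ly≤rv with y∈P─A , (_ , p≤ry) ← stab⁻ y∈
      = stab⁺ (p─q⊆p P A y∈P─A) (ℚP.≤-trans ly≤rv rv≤q , ℚP.≤-trans q≤p p≤ry)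

    A-absorbs : ∀ p → Nonempty (stab (P ─ A) p) → Absorbed P A p
    A-absorbs p (y , y∈) with y∈P─A , (ly≤p , _) ← stab⁻ y∈ | p ℚP.≤? r v
    ... | yes p≤rv = p , ℚP.≤-refl , stab-mono (p─q⊆p P A) , v , v∈A ,
                     (ℚP.≤-trans (v-least (p─q⊆p P A y∈P─A)) ly≤p , p≤rv)
    ... | no p≰rv with nonempty? (stab (R ─ A′) p)
    ...   | yes late-nonempty with q , q≤p , late⊆ , a , a∈A′ , (la≤q , q≤ra) ← A′-absorbs p late-nonempty
      = q , q≤p , ⊆stab , a , A′⊆A a∈A′ , (la≤q , q≤ra)
      where
      ⊆stab : stab (P ─ A) p ⊆ stab P q
      ⊆stab {y} y∈ with l y ℚP.≤? r v
      ... | yes ly≤rv = stab-early (ℚP.≤-trans (ℚP.<⇒≤ (A′-after a∈A′)) la≤q) q≤p y∈ ly≤rv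
      ... | no ly≰rv = stab-mono R⊆P (late⊆ (stab-late y∈ ly≰rv))
    ...   | no late-empty = r v , rv≤p , ⊆stab , v , v∈A , (l≤r v , ℚP.≤-refl)
      where
      rv≤p : r v ≤ p
      rv≤p = ℚP.<⇒≤ (ℚP.≰⇒> p≰rv)
      ⊆stab : stab (P ─ A) p ⊆ stab P (r v)
      ⊆stab {y} y∈ with l y ℚP.≤? r v
      ... | yes ly≤rv = stab-early ℚP.≤-refl rv≤p y∈ ly≤rv
      ... | no ly≰rv = ⊥-elim (late-empty (y , stab-late y∈ ly≰rv))

  after⊂ : ∀ {P v} → v ∈ P → after v P ⊂ P
  after⊂ {v = v} v∈P = proj₁ ∘ ∈-filter⁻ _ , v , v∈P ,
    λ v∈R → ℚP.<-irrefl refl (ℚP.<-≤-trans (proj₂ (∈-filter⁻ _ v∈R)) (l≤r v))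

  greedy-layer : ∀ P → Layer P
  greedy-layer = All.wfRec ⊂-wellFounded _ Layer step
    where
    step : ∀ P → WfRec _⊂_ Layer P → Layer P
    step P rec with nonempty? P
    ... | no P-empty = empty-layer P-empty
    ... | yes P-nonempty with v , v∈P , v-least ← least l P-nonempty
      = cons-layer v∈P v-least (rec (after⊂ v∈P))

  module _ {P} (L : Layer P) where
    open Layer L

    ─layer⊂ : Nonempty P → P ─ layer ⊂ P
    ─layer⊂ P-nonempty with a , a∈A ← nonempty P-nonempty
      = p∩q≢∅⇒p─q⊂p P layer (a , x∈p∩q⁺ (layer⊆P a∈A , a∈A))

    layer∉stab : ∀ {a p} → a ∈ layer → a ∉ stab (P ─ layer) p
    layer∉stab a∈A a∈ = x∈p─q⇒x∉q P layer (proj₁ (stab⁻ a∈)) a∈A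

    stab-⊂ : Nonempty P → ∀ p → ∃[ q ] stab (P ─ layer) p ⊂ stab P q
    stab-⊂ P-nonempty p with a₀ , a₀∈A ← nonempty P-nonempty | nonempty? (stab (P ─ layer) p)
    ... | yes ne with q , _ , ⊆stab , a , a∈A , covers ← absorbs p ne
      = q , ⊆stab , a , stab⁺ (layer⊆P a∈A) covers , layer∉stab a∈A
    ... | no empty
      = l a₀ , (λ y∈ → ⊥-elim (empty (_ , y∈))) ,
        a₀ , stab⁺ (layer⊆P a₀∈A) (ℚP.≤-refl , l≤r a₀) , layer∉stab a₀∈A

  module _ (x : Fin n → ℚ) (disjoint-light : ∀ A → PairwiseDisjoint A → sumOver x A ≤ 1ℚ) where

    StabBound : Subset n → Set
    StabBound P = ∃[ q ] sumOver x P ≤ fromℤ (+ ∣ stab P q ∣)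

    layer-step : ∀ {P} (L : Layer P) → Nonempty P → StabBound (P ─ Layer.layer L) → StabBound P
    layer-step {P} L P-nonempty (q′ , bound′) with q , stab′⊂stab ← stab-⊂ L P-nonempty q′ = q , (begin
      sumOver x P                             ≡⟨ sumOver-∩-─ x P layer ⟩
      sumOver x (P ∩ layer) + sumOver x (P ─ layer)
                                              ≤⟨ ℚP.+-mono-≤ (disjoint-light (P ∩ layer) ∩layer-disjoint) bound′ ⟩
      1ℚ + fromℤ (+ ∣ stab (P ─ layer) q′ ∣)  ≡⟨ fromℤ-homo-+ (+ 1) (+ ∣ stab (P ─ layer) q′ ∣) ⟨
      fromℤ (+ suc ∣ stab (P ─ layer) q′ ∣)   ≤⟨ fromℤ-mono-≤ (+≤+ (p⊂q⇒∣p∣<∣q∣ stab′⊂stab)) ⟩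
      fromℤ (+ ∣ stab P q ∣)                  ∎)
      where
      open Layer L
      open ℚP.≤-Reasoning
      ∩layer-disjoint : PairwiseDisjoint (P ∩ layer)
      ∩layer-disjoint a∈ b∈ = disjoint (p∩q⊆q P layer a∈) (p∩q⊆q P layer b∈)

    stab-bound : ∀ P → StabBound P
    stab-bound = All.wfRec ⊂-wellFounded _ StabBound step
      where
      step : ∀ P → WfRec _⊂_ StabBound P → StabBound P
      step P rec with nonempty? P
      ... | yes P-nonempty = layer-step L P-nonempty (rec (─layer⊂ L P-nonempty))
        where
        L : Layer P
        L = greedy-layer P
      ... | no P-empty = 0ℚ , (begin
        sumOver x P              ≡⟨ cong (sumOver x) (Empty-unique P-empty) ⟩
        sumOver x ⊥              ≡⟨ sumOver-⊥ x ⟩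
        0ℚ                       ≤⟨ fromℤ-mono-≤ (+≤+ z≤n) ⟩
        fromℤ (+ ∣ stab P 0ℚ ∣)  ∎)
        where open ℚP.≤-Reasoning

    heavy-clique : (∀ b → 0ℚ ≤ x b) → ∀ S →
                   ∃[ K ] K ⊆ S × (∀ {a b} → a ∈ K → b ∈ K → Overlap a b) × + ∣ K ∣ ≡ ⌈ sumOver x S ⌉
    heavy-clique x≥0 S
      with q , ∑≤∣stab∣ ← stab-bound S
      with k , k≤∣stab∣ , ⌈∑⌉≡k ← ⌈⌉-bounded _ _ (sumOver-nonNeg x x≥0 S) ∑≤∣stab∣
      with K , K⊆stab , ∣K∣≡k ← subset-of-size (stab S q) k≤∣stab∣
      = K , proj₁ ∘ stab⁻ ∘ K⊆stab , (λ a∈K b∈K → stab-overlap (K⊆stab a∈K) (K⊆stab b∈K)) ,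
        trans (cong +_ ∣K∣≡k) (sym ⌈∑⌉≡k)

  module _ {E : Graph n} (E⇔Overlap : ∀ u v → u ≢ v → E u v ⇔ Overlap u v) where

    disjoint⇒stable : ∀ {A} → PairwiseDisjoint A → IsStable E A
    disjoint⇒stable A-disjoint u v u∈A v∈A u≢v =
      A-disjoint u∈A v∈A u≢v ∘ Equivalence.to (E⇔Overlap u v u≢v)

    overlapping⇒clique : ∀ {K} → (∀ {a b} → a ∈ K → b ∈ K → Overlap a b) → IsClique E K
    overlapping⇒clique K-overlap u v u∈K v∈K u≢v =
      Equivalence.from (E⇔Overlap u v u≢v) (K-overlap u∈K v∈K)

open Intervals

theorem16 : ∀ {n d} (w : Size n d) (G : Fin d → Graph n) (w' : Size n d) →
    IsUnitSize w → IsPackingClass w G → IsConservativeScale w w' →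
    (i : Fin d) (S : Subset n) →
    Σ (Subset n) λ K → K ⊆ S × IsClique (G i) K ×
      (+ ∣ K ∣ ≡ ⌈ sumOver (λ b → w' b i) S ⌉)
theorem16 w G w' _ (interval , stable⇒fits , _) (w'≥0 , conservative) i S
  with l , r , l≤r , adjacent⇔overlap ← interval i
  with K , K⊆S , K-overlap , ∣K∣≡⌈∑⌉ ← heavy-clique l r l≤r (λ b → w' b i)
         (λ A A-disjoint →
            conservative i A (stable⇒fits i A (disjoint⇒stable l r l≤r adjacent⇔overlap A-disjoint)))
         (λ b → w'≥0 b i) S
  = K , K⊆S , overlapping⇒clique l r l≤r adjacent⇔overlap K-overlap , ∣K∣≡⌈∑⌉
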